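{- Let \(\mathcal U,\mathcal V\) be universes, \(P_{\mathcal U}\) a proposition in \(\mathcal U\), and \(\mathcal L_{\mathcal V}(P_{\mathcal U}):=\Sigma_{Q:\Omega_{\mathcal V}}(Q\to P_{\mathcal U})\), ordered by \((Q,f)\sqsubseteq(Q',f')\) iff \(Q\to Q'\). If \(\mathcal L_{\mathcal V}(P_{\mathcal U})\) has a maximal element with underlying proposition \(Q:\Omega_{\mathcal V}\), then \(P_{\mathcal U}\simeq Q\), this element is the greatest element of \(\mathcal L_{\mathcal V}(P_{\mathcal U})\), and in particular \(P_{\mathcal U}\) has size \(\mathcal V\). Conversely, if \(P_{\mathcal U}\) is equivalent to a proposition \(Q:\Omega_{\mathcal V}\), then \(Q\) (together with the map \(Q\to P_{\mathcal U}\)) is the greatest element of \(\mathcal L_{\mathcal V}(P_{\mathcal U})\).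
   Context: Setting: intensional Martin-Löf type theory with universes, function extensionality, propositional extensionality, propositional truncation; resizing not assumed. A proposition is a type with at most one element; \(\Omega_{\mathcal V}\) is the type of propositions in \(\mathcal V\). A type has size \(\mathcal V\) if it is equivalent to some type in \(\mathcal V\). An element \(m\) of a poset is maximal if \(m\sqsubseteq a\) implies \(a=m\) (equivalently \(a\sqsubseteq m\)). -}

module Defs where

open import Level using (Level; _⊔_) renaming (suc to lsuc)
open import Data.Product using (Σ; _,_; proj₁; proj₂)
open import Relation.Binary.PropositionalEquality using (_≡_)
open import Function.Bundles using (_↔_)

isProp : ∀ {ℓ} → Set ℓ → Set ℓ
isProp X = (x y : X) → x ≡ y

Ω : (v : Level) → Set (lsuc v)
Ω v = Σ (Set v) isProp

⟨_⟩ : ∀ {v} → Ω v → Set v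
⟨ Q ⟩ = proj₁ Q

L : ∀ {u} (v : Level) (P : Set u) → Set (lsuc v ⊔ u)
L v P = Σ (Ω v) (λ Q → ⟨ Q ⟩ → P)

prop : ∀ {u v} {P : Set u} → L v P → Set v
prop a = ⟨ proj₁ a ⟩

_⊑_ : ∀ {u v} {P : Set u} → L v P → L v P → Set v
a ⊑ b = prop a → prop b

Maximal : ∀ {u v} {P : Set u} → L v P → Set (lsuc v ⊔ u)
Maximal {P = P} m = (a : L _ P) → m ⊑ a → a ≡ m

Greatest : ∀ {u v} {P : Set u} → L v P → Set (lsuc v ⊔ u)
Greatest {P = P} m = (a : L _ P) → a ⊑ m

HasSize : ∀ {u} (v : Level) → Set u → Set (lsuc v ⊔ u)
HasSize v X = Σ (Set v) (λ Y → X ↔ Y)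

{-# OPTIONS --safe #-}
module Submission where

-- Any (Q , f) with P → Q is greatest, because every (Q' , f') then satisfies Q' → P → Q.
-- A point p : P gives the element (⊤ , const p), which lies above everything; a maximal
-- element must therefore equal it, so its proposition is inhabited whenever P is. Together
-- with f : Q → P this makes P and Q logically equivalent propositions, hence isomorphic.

open import Defs
open import Level using (Level)
open import Data.Product using (_,_; _×_; proj₂)
open import Data.Unit.Polymorphic using (⊤; tt)
open import Function.Base using (id)
open import Function.Bundles using (_↔_; Inverse; mk↔ₛ′)
open import Relation.Binary.PropositionalEquality using (refl; cong; subst)

private
  variable
    u v : Level

⊤Ω : Ω v
⊤Ω = ⊤ , λ _ _ → refl

isProp-↔ : ∀ {A : Set u} {B : Set v} → isProp A → isProp B → (A → B) → (B → A) → A ↔ B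
isProp-↔ isPropA isPropB to from =
  mk↔ₛ′ to from (λ _ → isPropB _ _) (λ _ → isPropA _ _)

const-L : {P : Set u} → P → L v P
const-L p = ⊤Ω , λ _ → p

⊑-const-L : {P : Set u} (m : L v P) (p : P) → m ⊑ const-L p
⊑-const-L m p _ = tt

Maximal⇒inhabited : {P : Set u} (m : L v P) → Maximal m → P → prop m
Maximal⇒inhabited m maximal p =
  subst id (cong prop (maximal (const-L p) (⊑-const-L m p))) tt

inhabited⇒Greatest : {P : Set u} (m : L v P) → (P → prop m) → Greatest m
inhabited⇒Greatest m P→m a x = P→m (proj₂ a x)

lemma4p3 : ∀ {u v : Level} (P : Set u) → isProp P →
    ((m : L v P) → Maximal m → (P ↔ prop m) × Greatest m × HasSize v P)
    × ((Q : Set v) (isPropQ : isProp Q) (e : P ↔ Q) →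
         Greatest {P = P} ((Q , isPropQ) , Inverse.from e))
lemma4p3 P isPropP = maximal⇒greatest , λ Q isPropQ e →
  inhabited⇒Greatest ((Q , isPropQ) , Inverse.from e) (Inverse.to e)
  where
  maximal⇒greatest : ∀ m → Maximal m → (P ↔ prop m) × Greatest m × HasSize _ P
  maximal⇒greatest m@((Q , isPropQ) , f) maximal = P↔Q , inhabited⇒Greatest m P→Q , (Q , P↔Q)
    where
    P→Q : P → Q
    P→Q = Maximal⇒inhabited m maximal
    P↔Q : P ↔ Q
    P↔Q = isProp-↔ isPropP isPropQ P→Q f
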